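{- Let $D=(A,B,\lambda)$ be a temporal bi-clique with $A,B$ nonempty and $\lambda$ injective. Then $D$ is extremally matched or $D$ has a dismountable vertex.
   Context: A temporal bi-clique $(A,B,\lambda)$ is the complete bipartite graph with disjoint parts $A,B$ with an edge labeling $\lambda$ into $\mathbb{N}$. For a vertex $v$, $\pi^-(v)$ is the neighbor $u$ of $v$ minimizing $\lambda(\{v,u\})$ and $\pi^+(v)$ the neighbor maximizing it. $D$ is extremally matched if both $\{\{v,\pi^-(v)\}: v\in A\cup B\}$ and $\{\{v,\pi^+(v)\}: v\in A\cup B\}$ are perfect matchings of the complete bipartite graph on $A\sqcup B$. A vertex $a\in A$ is dismountable if there is $a'\in A$, $a'\ne a$, with $\lambda(\{a,\pi^-(a')\})\le\lambda(\{a',\pi^-(a')\})$. A vertex $b\in B$ is dismountable if there is $b'\in B$, $b'\ne b$, with $\lambda(\{b',\pi^+(b')\})\le\lambda(\{b,\pi^+(b')\})$. -}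

module Defs where

open import Data.Nat using (ℕ; _≤_)
open import Data.Fin using (Fin)
open import Data.Product using (Σ; _×_; ∃; ∃-syntax)
open import Data.Sum using (_⊎_)
open import Relation.Binary.PropositionalEquality using (_≡_; _≢_)

-- A temporal bi-clique with parts A = Fin m, B = Fin n; the label of the
-- edge {a,b} (a ∈ A, b ∈ B) is  lab a b.
Labeling : ℕ → ℕ → Set
Labeling m n = Fin m → Fin n → ℕ

InjectiveLabeling : ∀ {m n} → Labeling m n → Set
InjectiveLabeling {m} {n} lab =
  ∀ (a a' : Fin m) (b b' : Fin n) → lab a b ≡ lab a' b' → a ≡ a' × b ≡ b'

module _ {m n : ℕ} (lab : Labeling m n) where

  IsPiMinusA : Fin m → Fin n → Set
  IsPiMinusA a b = ∀ (b' : Fin n) → lab a b ≤ lab a b'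

  IsPiMinusB : Fin n → Fin m → Set
  IsPiMinusB b a = ∀ (a' : Fin m) → lab a b ≤ lab a' b

  IsPiPlusA : Fin m → Fin n → Set
  IsPiPlusA a b = ∀ (b' : Fin n) → lab a b' ≤ lab a b

  IsPiPlusB : Fin n → Fin m → Set
  IsPiPlusB b a = ∀ (a' : Fin m) → lab a' b ≤ lab a b

  -- edge sets {{v, π⁻(v)}} and {{v, π⁺(v)}}, as relations between A and B
  MinEdge : Fin m → Fin n → Set
  MinEdge a b = IsPiMinusA a b ⊎ IsPiMinusB b a

  MaxEdge : Fin m → Fin n → Set
  MaxEdge a b = IsPiPlusA a b ⊎ IsPiPlusB b a

IsPerfectMatching : ∀ {m n} → (Fin m → Fin n → Set) → Set
IsPerfectMatching {m} {n} E =
  (∀ (a : Fin m) → Σ (Fin n) λ b → E a b × (∀ (b' : Fin n) → E a b' → b' ≡ b))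
  × (∀ (b : Fin n) → Σ (Fin m) λ a → E a b × (∀ (a' : Fin m) → E a' b → a' ≡ a))

ExtremallyMatched : ∀ {m n} → Labeling m n → Set
ExtremallyMatched lab = IsPerfectMatching (MinEdge lab) × IsPerfectMatching (MaxEdge lab)

DismountableA : ∀ {m n} → Labeling m n → Fin m → Set
DismountableA {m} {n} lab a =
  Σ (Fin m) λ a' → Σ (Fin n) λ b →
    a' ≢ a × IsPiMinusA lab a' b × lab a b ≤ lab a' b

DismountableB : ∀ {m n} → Labeling m n → Fin n → Set
DismountableB {m} {n} lab b =
  Σ (Fin n) λ b' → Σ (Fin m) λ a →
    b' ≢ b × IsPiPlusB lab b' a × lab a b' ≤ lab a b

HasDismountableVertex : ∀ {m n} → Labeling m n → Set
HasDismountableVertex {m} {n} lab =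
  (Σ (Fin m) λ a → DismountableA lab a) ⊎ (Σ (Fin n) λ b → DismountableB lab b)

module Submission where

-- Send a ∈ A to its earliest neighbour π⁻(a) and back to π⁻(π⁻(a)). If this
-- round trip ever misses a, then π⁻(π⁻(a)) is dismountable, witnessed by a.
-- Dually for B with latest neighbours π⁺. If neither happens, π⁻ : A → B and
-- π⁺ : B → A have left inverses, so both are injective, |A| = |B|, and both are
-- bijections; injectivity of λ makes each extremal neighbour unique, so the
-- min-edges are exactly the graph of π⁻ on A and the max-edges that of π⁺ on B.

open import Defs
open import Data.Nat using (ℕ; suc; _≤_; s≤s; s≤s⁻¹)
open import Data.Nat.Properties using (≤-isTotalOrder; ≤-trans; 1+n≰n)
open import Data.Fin using (Fin; zero; suc; punchOut)
open import Data.Fin.Properties using (_≟_; all?; any?; ¬∀⟶∃¬; injective⇒≤; punchOut-injective)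
open import Data.Product using (Σ; ∃; _×_; _,_; proj₁; proj₂; swap)
open import Data.Sum as Sum using (_⊎_; inj₁; inj₂)
open import Function using (_∘_; flip)
open import Function.Definitions using (Injective; StrictlySurjective; StrictlyInverseʳ)
open import Function.Consequences.Propositional using (inverseʳ⇒injective; strictlyInverseʳ⇒inverseʳ)
open import Level using (Level; 0ℓ)
open import Relation.Binary.Core using (Rel)
open import Relation.Binary.Structures using (IsTotalPreorder; IsTotalOrder)
import Relation.Binary.Construct.Flip.EqAndOrd as Flip
open import Relation.Binary.PropositionalEquality using (_≡_; _≢_; refl; sym; trans; cong; subst)
open import Relation.Nullary using (yes; no; contradiction)

private
  variable
    c ℓ ℓ′ : Level
    m n : ℕ

module _ {A : Set c} {_≈_ : Rel A ℓ} {_≲_ : Rel A ℓ′}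
         (≲-isTotalPreorder : IsTotalPreorder _≈_ _≲_) where

  open IsTotalPreorder ≲-isTotalPreorder using (total)
    renaming (refl to ≲-refl; trans to ≲-trans)

  argmin : ∀ k (f : Fin (suc k) → A) → ∃ λ i → ∀ j → f i ≲ f j
  argmin 0       f = zero , λ { zero → ≲-refl }
  argmin (suc k) f with argmin k (f ∘ suc)
  ... | i , least with total (f zero) (f (suc i))
  ...   | inj₁ f₀≲fᵢ = zero  , λ { zero → ≲-refl ; (suc j) → ≲-trans f₀≲fᵢ (least j) }
  ...   | inj₂ fᵢ≲f₀ = suc i , λ { zero → fᵢ≲f₀  ; (suc j) → least j }

injective⇒strictlySurjective : {f : Fin m → Fin n} → Injective _≡_ _≡_ f → n ≤ m →
                               StrictlySurjective _≡_ f
injective⇒strictlySurjective {m} {suc n} {f} f-injective n≤m b with any? (λ a → f a ≟ b)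
... | yes hit = hit
... | no miss = contradiction (≤-trans n≤m (injective⇒≤ {f = punched} punched-injective)) 1+n≰n
  where
  b≢f : ∀ a → b ≢ f a
  b≢f a b≡fa = miss (a , sym b≡fa)

  punched : Fin m → Fin n
  punched a = punchOut (b≢f a)

  punched-injective : Injective _≡_ _≡_ punched
  punched-injective {a} {a′} = f-injective ∘ punchOut-injective (b≢f a) (b≢f a′)

graph⇒perfectMatching : (E : Fin m → Fin n → Set) (f : Fin m → Fin n) →
                        Injective _≡_ _≡_ f → StrictlySurjective _≡_ f →
                        (∀ a → E a (f a)) → (∀ {a b} → E a b → b ≡ f a) →
                        IsPerfectMatching E
graph⇒perfectMatching E f f-injective f-surjective on-graph in-graph =
  (λ a → f a , on-graph a , λ _ → in-graph) ,
  λ b → let (a , fa≡b) = f-surjective b in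
    a , subst (E a) fa≡b (on-graph a) ,
    λ _ e → f-injective (trans (sym (in-graph e)) (sym fa≡b))

perfectMatching-resp : {E F : Fin m → Fin n → Set} →
                       (∀ {a b} → E a b → F a b) → (∀ {a b} → F a b → E a b) →
                       IsPerfectMatching E → IsPerfectMatching F
perfectMatching-resp E⇒F F⇒E (matchA , matchB) =
  (λ a → let (b , e , unique) = matchA a in b , E⇒F e , λ b′ → unique b′ ∘ F⇒E) ,
  (λ b → let (a , e , unique) = matchB b in a , E⇒F e , λ a′ → unique a′ ∘ F⇒E)

transpose-injective : {lab : Labeling m n} → InjectiveLabeling lab →
                      InjectiveLabeling (flip lab)
transpose-injective injective b b′ a a′ eq = swap (injective a a′ b b′ eq)

module BestNeighbours {_≼_ : Rel ℕ 0ℓ} (≼-isTotalOrder : IsTotalOrder _≡_ _≼_)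
                      (lab : Labeling (suc m) (suc n)) (lab-injective : InjectiveLabeling lab)
                      where

  open IsTotalOrder ≼-isTotalOrder using (antisym; isTotalPreorder)

  RowBest : Fin (suc m) → Fin (suc n) → Set
  RowBest a b = ∀ b′ → lab a b ≼ lab a b′

  ColBest : Fin (suc n) → Fin (suc m) → Set
  ColBest b a = ∀ a′ → lab a b ≼ lab a′ b

  BestEdge : Fin (suc m) → Fin (suc n) → Set
  BestEdge a b = RowBest a b ⊎ ColBest b a

  Dismountable : Fin (suc m) → Set
  Dismountable a₀ = Σ (Fin (suc m)) λ a → Σ (Fin (suc n)) λ b →
    a ≢ a₀ × RowBest a b × lab a₀ b ≼ lab a b

  rowBest : Fin (suc m) → Fin (suc n)
  rowBest a = proj₁ (argmin isTotalPreorder n (lab a))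

  rowBest-best : ∀ a → RowBest a (rowBest a)
  rowBest-best a = proj₂ (argmin isTotalPreorder n (lab a))

  colBest : Fin (suc n) → Fin (suc m)
  colBest b = proj₁ (argmin isTotalPreorder m (λ a → lab a b))

  colBest-best : ∀ b → ColBest b (colBest b)
  colBest-best b = proj₂ (argmin isTotalPreorder m (λ a → lab a b))

  rowBest-unique : ∀ {a b} → RowBest a b → b ≡ rowBest a
  rowBest-unique {a} best =
    proj₂ (lab-injective a a _ _ (antisym (best (rowBest a)) (rowBest-best a _)))

  colBest-unique : ∀ {a b} → ColBest b a → a ≡ colBest b
  colBest-unique {b = b} best =
    proj₁ (lab-injective _ _ b b (antisym (best (colBest b)) (colBest-best b _)))

  colBest∘rowBest-dismountable : ∀ a → colBest (rowBest a) ≢ a → Dismountable (colBest (rowBest a))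
  colBest∘rowBest-dismountable a a↛a =
    a , rowBest a , a↛a ∘ sym , rowBest-best a , colBest-best (rowBest a) a

  dismountable⊎colBest-inverseʳ : (∃ Dismountable) ⊎ StrictlyInverseʳ _≡_ rowBest colBest
  dismountable⊎colBest-inverseʳ with all? (λ a → colBest (rowBest a) ≟ a)
  ... | yes inverse = inj₂ inverse
  ... | no ¬inverse =
    let (a , a↛a) = ¬∀⟶∃¬ _ _ (λ a → colBest (rowBest a) ≟ a) ¬inverse in
    inj₁ (_ , colBest∘rowBest-dismountable a a↛a)

  module _ (inverse : StrictlyInverseʳ _≡_ rowBest colBest) where

    rowBest-injective : Injective _≡_ _≡_ rowBest
    rowBest-injective =
      inverseʳ⇒injective {f⁻¹ = colBest} rowBest (strictlyInverseʳ⇒inverseʳ rowBest inverse)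

    module _ (n≤m : n ≤ m) where

      rowBest-surjective : StrictlySurjective _≡_ rowBest
      rowBest-surjective = injective⇒strictlySurjective rowBest-injective (s≤s n≤m)

      bestEdge⇒rowBest : ∀ {a b} → BestEdge a b → b ≡ rowBest a
      bestEdge⇒rowBest (inj₁ best) = rowBest-unique best
      bestEdge⇒rowBest {b = b} (inj₂ best) with rowBest-surjective b
      ... | a′ , refl = cong rowBest (trans (sym (inverse a′)) (sym (colBest-unique best)))

      bestEdge-perfectMatching : IsPerfectMatching BestEdge
      bestEdge-perfectMatching = graph⇒perfectMatching BestEdge rowBest rowBest-injective
        rowBest-surjective (inj₁ ∘ rowBest-best) bestEdge⇒rowBest

theorem16 : (m n : ℕ) (lab : Labeling (suc m) (suc n)) →
    InjectiveLabeling lab →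
    ExtremallyMatched lab ⊎ HasDismountableVertex lab
theorem16 m n lab injective = extremallyMatched⊎dismountable
  where
  module Min = BestNeighbours ≤-isTotalOrder lab injective
  -- The latest neighbours of λ are the earliest ones of the transposed
  -- bi-clique ordered by ≥; BestEdge and Dismountable then unfold to
  -- MaxEdge (up to swapping the sum) and DismountableB.
  module Max = BestNeighbours (Flip.isTotalOrder ≤-isTotalOrder) (flip lab)
                              (transpose-injective injective)

  extremallyMatched⊎dismountable : ExtremallyMatched lab ⊎ HasDismountableVertex lab
  extremallyMatched⊎dismountable
    with Min.dismountable⊎colBest-inverseʳ | Max.dismountable⊎colBest-inverseʳ
  ... | inj₁ dismountableA | _                  = inj₂ (inj₁ dismountableA)
  ... | inj₂ _             | inj₁ dismountableB = inj₂ (inj₂ dismountableB)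
  ... | inj₂ inverseA      | inj₂ inverseB      =
    inj₁ ( Min.bestEdge-perfectMatching inverseA n≤m
         , perfectMatching-resp Sum.swap Sum.swap
             (swap (Max.bestEdge-perfectMatching inverseB m≤n)) )
    where
    m≤n : m ≤ n
    m≤n = s≤s⁻¹ (injective⇒≤ (Min.rowBest-injective inverseA))

    n≤m : n ≤ m
    n≤m = s≤s⁻¹ (injective⇒≤ (Max.rowBest-injective inverseB))
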